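{- There exists a family of regular $\omega$-trees $t_1,t_2,\dots$ such that $t_n$ can be represented by a regular $\omega$-tree automaton with $n+2$ states, but the smallest deterministic Büchi word acceptor recognizing $\mathrm{paths}(t_n)$ has at least $2^n$ states.
   Context: A regular $\omega$-tree automaton $A_t=(Q,q_0,\delta,\tau)$ over a finite alphabet $\Sigma$ and directions $D=\{1,\dots,d\}$ (for some $d$) is a complete deterministic finite automaton over $D$ with output $\tau:Q\times D\to\Sigma$, representing the tree $t:D^+\to\Sigma$ with $t(x'i)=\tau(\delta(q_0,x'),i)$; a regular $\omega$-tree is one so representable. $\mathrm{paths}(t)$ is the set of $\omega$-words $t(x_1)t(x_2)\cdots$ over infinite paths $x_0=\varepsilon,x_1,\dots$ from the root. A deterministic Büchi word acceptor accepts $w$ iff its unique run exists and visits an accepting state infinitely often. -}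

module Defs where

open import Data.Nat using (ℕ; zero; suc; _≤_)
open import Data.Fin using (Fin)
open import Data.List using (List; []; _∷_; foldl)
open import Data.Bool using (Bool; true)
open import Data.Maybe using (Maybe; just)
open import Data.Product using (Σ; _×_; ∃; ∃-syntax)
open import Relation.Binary.PropositionalEquality using (_≡_)

-- An ω-tree t : D⁺ → Σ over alphabet Fin s and directions Fin d, written in
-- curried form: the label at node x'i is  t x' i  (x' ∈ D*, i ∈ D).
Tree : ℕ → ℕ → Set
Tree s d = List (Fin d) → Fin d → Fin s

record TreeAut (s d k : ℕ) : Set where
  field
    q₀ : Fin k
    δ  : Fin k → Fin d → Fin k
    τ  : Fin k → Fin d → Fin s

  δ* : Fin k → List (Fin d) → Fin k
  δ* q xs = foldl δ q xs

Represents : ∀ {s d k} → TreeAut s d k → Tree s d → Set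
Represents A t = ∀ x' i → t x' i ≡ TreeAut.τ A (TreeAut.δ* A (TreeAut.q₀ A) x') i

ωWord : ℕ → Set
ωWord s = ℕ → Fin s

take : ∀ {d} → (ℕ → Fin d) → ℕ → List (Fin d)
take f zero = []
take f (suc n) = f zero ∷ take (λ m → f (suc m)) n

-- paths(t): words t(x₁)t(x₂)⋯ where x_{k+1} = x_k·(dir k), x₀ = ε.
-- The (k+1)-st node is  take dir k · dir k, so the k-th letter is t (take dir k) (dir k).
inPaths : ∀ {s d} → Tree s d → ωWord s → Set
inPaths t w = ∃[ dir ] (∀ k → w k ≡ t (take dir k) (dir k))

record DBA (s m : ℕ) : Set where
  field
    q₀  : Fin m
    δ   : Fin m → Fin s → Maybe (Fin m)
    acc : Fin m → Bool

Accepts : ∀ {s m} → DBA s m → ωWord s → Set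
Accepts B w =
  Σ (ℕ → Fin _) λ r →
    (r 0 ≡ DBA.q₀ B)
    × (∀ k → DBA.δ B (r k) (w k) ≡ just (r (suc k)))
    × (∀ N → ∃[ k ] (N ≤ k × DBA.acc B (r k) ≡ true))

RecognizesPaths : ∀ {s d m} → DBA s m → Tree s d → Set
RecognizesPaths B t = ∀ w → (Accepts B w → inPaths t w) × (inPaths t w → Accepts B w)

-- The tree tₙ is generated by a counter with states 0, …, n + 1 over letters and directions
-- A, B, C.  State 0 copies the directions A and B; direction C makes it emit A and start
-- counting; the states below n emit only A and B, and the states n and n + 1 emit only C.
-- Hence paths(tₙ) consists of the C-free words and of the words whose first C comes exactly
-- n letters after an A and is followed only by C.  A deterministic Büchi acceptor of this
-- language reaches distinct states after distinct prefixes u, v ∈ {A, B}ⁿ: if u has A and v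
-- has B at position j, then u Bʲ C^ω is accepted and v Bʲ C^ω is not, whereas equal states
-- would let the accepting run on the former be transplanted onto the latter.
module Submission where

open import Defs
open import Data.Nat using (ℕ; zero; suc; _+_; _∸_; _^_; _⊓_; _≤_; _<_; z≤n; s≤s; _≤?_; _<?_; _≟_)
open import Data.Nat.Properties
open import Data.Fin using (Fin; zero; suc; toℕ; fromℕ<; inject₁; combine; finToFun; funToFin)
open import Data.Fin.Properties using (toℕ-fromℕ<; injective⇒≤; funToFin-finToFin)
open import Data.List using ([]; _∷_; _∷ʳ_; foldl)
open import Data.List.Properties using (foldl-∷ʳ)
open import Data.Bool using (true)
open import Data.Maybe using (just)
open import Data.Maybe.Properties using (just-injective)
open import Data.Product using (Σ; _×_; _,_; proj₁; proj₂; ∃-syntax)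
open import Data.Sum using (_⊎_; inj₁; inj₂)
open import Data.Empty using (⊥-elim)
open import Function using (_∘_)
open import Relation.Nullary using (¬_; Dec; yes; no)
open import Relation.Binary.PropositionalEquality

funToFin-cong : ∀ {k n} {u v : Fin n → Fin k} → u ≗ v → funToFin u ≡ funToFin v
funToFin-cong {n = zero}  u≗v = refl
funToFin-cong {n = suc n} u≗v = cong₂ combine (u≗v zero) (funToFin-cong (u≗v ∘ suc))

^≤-of-pointwise-injective : ∀ {k n m} (g : (Fin n → Fin k) → Fin m) →
                            (∀ {u v} → g u ≡ g v → u ≗ v) → k ^ n ≤ m
^≤-of-pointwise-injective {k} {n} g inj = injective⇒≤ {f = g ∘ finToFun} λ {i} {j} gi≡gj →
  trans (sym (funToFin-finToFin {n} {k} i))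
        (trans (funToFin-cong (inj gi≡gj)) (funToFin-finToFin {n} {k} j))

infixr 5 _++ʷ_

_++ʷ_ : ∀ {X : Set} {n} → (Fin n → X) → (ℕ → X) → ℕ → X
_++ʷ_ {n = zero}  u w k       = w k
_++ʷ_ {n = suc n} u w zero    = u zero
_++ʷ_ {n = suc n} u w (suc k) = (u ∘ suc ++ʷ w) k

module _ {X : Set} where

  ++ʷ-toℕ : ∀ {n} (u : Fin n → X) (w : ℕ → X) i → (u ++ʷ w) (toℕ i) ≡ u i
  ++ʷ-toℕ u w zero    = refl
  ++ʷ-toℕ u w (suc i) = ++ʷ-toℕ (u ∘ suc) w i

  ++ʷ-prefix : ∀ {n} (u : Fin n → X) {x y : ℕ → X} {k} → k < n → (u ++ʷ x) k ≡ (u ++ʷ y) k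
  ++ʷ-prefix u {k = zero}  (s≤s _)   = refl
  ++ʷ-prefix u {k = suc k} (s≤s k<n) = ++ʷ-prefix (u ∘ suc) k<n

  ++ʷ-suffix : ∀ {n} (u v : Fin n → X) {w : ℕ → X} {k} → n ≤ k → (u ++ʷ w) k ≡ (v ++ʷ w) k
  ++ʷ-suffix {zero}  u v z≤n                   = refl
  ++ʷ-suffix {suc n} u v {k = suc k} (s≤s n≤k) = ++ʷ-suffix (u ∘ suc) (v ∘ suc) n≤k

  module _ (P : X → Set) where

    ++ʷ-all : ∀ {n} {u : Fin n → X} {w : ℕ → X} →
              (∀ i → P (u i)) → (∀ k → P (w k)) → ∀ k → P ((u ++ʷ w) k)
    ++ʷ-all {zero}  Pu Pw k       = Pw k
    ++ʷ-all {suc n} Pu Pw zero    = Pu zero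
    ++ʷ-all {suc n} Pu Pw (suc k) = ++ʷ-all (Pu ∘ suc) Pw k

    ++ʷ-below : ∀ {n m} {u : Fin n → X} {w : ℕ → X} →
                (∀ i → P (u i)) → (∀ k → k < m → P (w k)) → ∀ k → k < n + m → P ((u ++ʷ w) k)
    ++ʷ-below {zero}  Pu Pw k       k<m         = Pw k k<m
    ++ʷ-below {suc n} Pu Pw zero    _           = Pu zero
    ++ʷ-below {suc n} Pu Pw (suc k) (s≤s k<n+m) = ++ʷ-below (Pu ∘ suc) Pw k k<n+m

    ++ʷ-above : ∀ {n m} {u : Fin n → X} {w : ℕ → X} →
                (∀ k → m ≤ k → P (w k)) → ∀ k → n + m ≤ k → P ((u ++ʷ w) k)
    ++ʷ-above {zero}          Pw k       m≤k         = Pw k m≤k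
    ++ʷ-above {suc n} {u = u} Pw (suc k) (s≤s n+m≤k) = ++ʷ-above {u = u ∘ suc} Pw k n+m≤k

module _ {s m} (M : DBA s m) where
  open DBA M

  run : ∀ {w} → Accepts M w → ℕ → Fin m
  run = proj₁

  run-agree : ∀ n {w₁ w₂} (a₁ : Accepts M w₁) (a₂ : Accepts M w₂) →
              (∀ k → k < n → w₁ k ≡ w₂ k) → run a₁ n ≡ run a₂ n
  run-agree zero    (_ , start₁ , _) (_ , start₂ , _) _ = trans start₁ (sym start₂)
  run-agree (suc n) {w₁} {w₂} a₁@(r₁ , _ , step₁ , _) a₂@(r₂ , _ , step₂ , _) agree =
    just-injective (begin
      just (r₁ (suc n))  ≡⟨ step₁ n ⟨
      δ (r₁ n) (w₁ n)    ≡⟨ cong₂ δ (run-agree n a₁ a₂ (λ k → agree k ∘ m<n⇒m<1+n)) (agree n ≤-refl) ⟩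
      δ (r₂ n) (w₂ n)    ≡⟨ step₂ n ⟩
      just (r₂ (suc n))  ∎)
    where open ≡-Reasoning

  accepts-splice : ∀ {n w w₁ w₂} (a₁ : Accepts M w₁) (a₂ : Accepts M w₂) → run a₁ n ≡ run a₂ n →
                   (∀ k → k < n → w k ≡ w₁ k) → (∀ k → n ≤ k → w k ≡ w₂ k) → Accepts M w
  accepts-splice {n} {w} {w₁} {w₂} (r₁ , start₁ , step₁ , _) (r₂ , _ , step₂ , live₂) meet before after =
    r , r-start , r-step , r-live
    where
    r : ℕ → Fin m
    r k with k <? n
    ... | yes _ = r₁ k
    ... | no  _ = r₂ k

    r-before : ∀ {k} → k < n → r k ≡ r₁ k
    r-before {k} k<n with k <? n
    ... | yes _   = refl
    ... | no  k≮n = ⊥-elim (k≮n k<n)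

    r-after : ∀ {k} → n ≤ k → r k ≡ r₂ k
    r-after {k} n≤k with k <? n
    ... | yes k<n = ⊥-elim (≤⇒≯ n≤k k<n)
    ... | no  _   = refl

    r-upto : ∀ {k} → k ≤ n → r k ≡ r₁ k
    r-upto k≤n with m≤n⇒m<n∨m≡n k≤n
    ... | inj₁ k<n  = r-before k<n
    ... | inj₂ refl = trans (r-after ≤-refl) (sym meet)

    r-start : r 0 ≡ q₀
    r-start = trans (r-upto z≤n) start₁

    r-step : ∀ k → δ (r k) (w k) ≡ just (r (suc k))
    r-step k = step-by (k <? n)
      where
      step-by : Dec (k < n) → δ (r k) (w k) ≡ just (r (suc k))
      step-by (yes k<n) = trans (cong₂ δ (r-before k<n) (before k k<n))
                                (trans (step₁ k) (cong just (sym (r-upto k<n))))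
      step-by (no k≮n)  = trans (cong₂ δ (r-after n≤k) (after k n≤k))
                                (trans (step₂ k) (cong just (sym (r-after (m≤n⇒m≤1+n n≤k)))))
        where n≤k = ≮⇒≥ k≮n

    r-live : ∀ N → ∃[ k ] (N ≤ k × acc (r k) ≡ true)
    r-live N with live₂ (N + n)
    ... | k , N+n≤k , accepting =
      k , m+n≤o⇒m≤o N N+n≤k , trans (cong acc (r-after (m+n≤o⇒n≤o N N+n≤k))) accepting

  accepts-swap-prefix : ∀ {n} (u v : Fin n → Fin s) {x x′ y} (a : Accepts M (u ++ʷ x))
                        (b : Accepts M (v ++ʷ x′)) → run a n ≡ run b n →
                        Accepts M (u ++ʷ y) → Accepts M (v ++ʷ y)
  accepts-swap-prefix {n} u v a b a≡b c =
    accepts-splice b c (trans (sym a≡b) (run-agree n a c (λ _ → ++ʷ-prefix u)))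
                   (λ _ → ++ʷ-prefix v) (λ _ → ++ʷ-suffix v u)

module _ {s d k : ℕ} (next : ℕ → Fin d → ℕ) (out : ℕ → Fin d → Fin s)
         (next<k : ∀ q i → next q i < k) (0<k : 0 < k) where

  boundedAut : TreeAut s d k
  boundedAut = record
    { q₀ = fromℕ< 0<k
    ; δ  = λ q i → fromℕ< (next<k (toℕ q) i)
    ; τ  = λ q i → out (toℕ q) i
    }

  toℕ-δ* : ∀ q xs → toℕ (TreeAut.δ* boundedAut q xs) ≡ foldl next (toℕ q) xs
  toℕ-δ* q []       = refl
  toℕ-δ* q (x ∷ xs) = trans (toℕ-δ* _ xs) (cong (λ p → foldl next p xs) (toℕ-fromℕ< _))

  boundedAut-represents : Represents boundedAut (λ x′ i → out (foldl next 0 x′) i)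
  boundedAut-represents x′ i =
    cong (λ q → out q i) (sym (trans (toℕ-δ* _ x′) (cong (λ p → foldl next p x′) (toℕ-fromℕ< 0<k))))

take-suc : ∀ {d} (dir : ℕ → Fin d) k → take dir (suc k) ≡ take dir k ∷ʳ dir k
take-suc dir zero    = refl
take-suc dir (suc k) = cong (dir 0 ∷_) (take-suc (dir ∘ suc) k)

foldl-take-suc : ∀ {X : Set} {d} (f : X → Fin d → X) q (dir : ℕ → Fin d) k →
                 foldl f q (take dir (suc k)) ≡ f (foldl f q (take dir k)) (dir k)
foldl-take-suc f q dir k = trans (cong (foldl f q) (take-suc dir k)) (foldl-∷ʳ f q (dir k) (take dir k))

pattern A = zero
pattern B = suc zero
pattern C = suc (suc zero)

toAB : Fin 3 → Fin 3
toAB C = A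
toAB x = x

toAB≢C : ∀ x → toAB x ≢ C
toAB≢C A ()
toAB≢C B ()
toAB≢C C ()

toAB-≢C : ∀ {x} → x ≢ C → toAB x ≡ x
toAB-≢C {A} _   = refl
toAB-≢C {B} _   = refl
toAB-≢C {C} x≢C = ⊥-elim (x≢C refl)

next : ℕ → ℕ → Fin 3 → ℕ
next n zero    C = 1
next n zero    _ = 0
next n (suc q) _ = suc (suc q ⊓ n)

out : ℕ → ℕ → Fin 3 → Fin 3
out n q i with q <? n
... | yes _ = toAB i
... | no  _ = C

tree : ℕ → Tree 3 3
tree n x′ i = out n (foldl (next n) 0 x′) i

state : ℕ → (ℕ → Fin 3) → ℕ → ℕ
state n dir k = foldl (next n) 0 (take dir k)

module _ {n : ℕ} where

  out-< : ∀ {q i} → q < n → out n q i ≡ toAB i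
  out-< {q} q<n with q <? n
  ... | yes _   = refl
  ... | no  q≮n = ⊥-elim (q≮n q<n)

  out-≥ : ∀ {q i} → n ≤ q → out n q i ≡ C
  out-≥ {q} n≤q with q <? n
  ... | yes q<n = ⊥-elim (≤⇒≯ n≤q q<n)
  ... | no  _   = refl

  out≡C⇒≥ : ∀ {q i} → out n q i ≡ C → n ≤ q
  out≡C⇒≥ {q} {i} out≡C with q <? n
  ... | yes _   = ⊥-elim (toAB≢C i out≡C)
  ... | no  q≮n = ≮⇒≥ q≮n

  next-≤ : ∀ q i → next n q i ≤ suc n
  next-≤ zero    C = s≤s z≤n
  next-≤ zero    A = z≤n
  next-≤ zero    B = z≤n
  next-≤ (suc q) _ = s≤s (m⊓n≤n (suc q) n)

  next-idle : ∀ {i} → i ≢ C → next n 0 i ≡ 0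
  next-idle {A} _   = refl
  next-idle {B} _   = refl
  next-idle {C} C≢C = ⊥-elim (C≢C refl)

  next-counting : ∀ {q} i → suc q ≤ n → next n (suc q) i ≡ suc (suc q)
  next-counting _ 1+q≤n = cong suc (m≤n⇒m⊓n≡m 1+q≤n)

  next-saturated : ∀ {q i} → n ≤ q → n ≤ next n q i
  next-saturated {zero}  z≤n = z≤n
  next-saturated {suc q} n≤q = m≤n⇒m≤1+n (≤-reflexive (sym (m≥n⇒m⊓n≡n n≤q)))

  next≡1⇒out≡A : ∀ {q i} → 0 < n → next n q i ≡ 1 → out n q i ≡ A
  next≡1⇒out≡A {zero}  {C} 0<n _ = out-< 0<n
  next≡1⇒out≡A {zero}  {A} _ ()
  next≡1⇒out≡A {zero}  {B} _ ()
  next≡1⇒out≡A {suc q} {_} (s≤s z≤n) ()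

  next≡2+c⇒≡1+c : ∀ {q i c} → suc c < n → next n q i ≡ suc (suc c) → q ≡ suc c
  next≡2+c⇒≡1+c {zero}  {C} _ ()
  next≡2+c⇒≡1+c {zero}  {A} _ ()
  next≡2+c⇒≡1+c {zero}  {B} _ ()
  next≡2+c⇒≡1+c {suc q} 1+c<n next≡ with ⊓-sel (suc q) n
  ... | inj₁ ⊓≡q = trans (sym ⊓≡q) (suc-injective next≡)
  ... | inj₂ ⊓≡n = ⊥-elim (<-irrefl (trans (sym (suc-injective next≡)) ⊓≡n) 1+c<n)

  next≡1+n⇒≥ : ∀ {q i} → 0 < n → next n q i ≡ suc n → n ≤ q
  next≡1+n⇒≥ {zero}  {C} (s≤s z≤n) ()
  next≡1+n⇒≥ {zero}  {A} _ ()
  next≡1+n⇒≥ {zero}  {B} _ ()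
  next≡1+n⇒≥ {suc q} _ next≡ = m⊓n≡n⇒n≤m (suc-injective next≡)

module _ {n : ℕ} (dir : ℕ → Fin 3) where

  state-suc : ∀ k → state n dir (suc k) ≡ next n (state n dir k) (dir k)
  state-suc = foldl-take-suc (next n) 0 dir

  state-idle : ∀ {k} → (∀ i → i < k → dir i ≢ C) → state n dir k ≡ 0
  state-idle {zero}  _    = refl
  state-idle {suc k} idle = begin
    state n dir (suc k)             ≡⟨ state-suc k ⟩
    next n (state n dir k) (dir k)  ≡⟨ cong (λ q → next n q (dir k)) (state-idle (λ i → idle i ∘ m<n⇒m<1+n)) ⟩
    next n 0 (dir k)                ≡⟨ next-idle (idle k ≤-refl) ⟩
    0                               ∎
    where open ≡-Reasoning

  state-counting : ∀ {j} → state n dir (suc j) ≡ 1 →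
                   ∀ c → c < n → state n dir (suc (c + j)) ≡ suc c
  state-counting start zero    _     = start
  state-counting {j} start (suc c) 1+c<n = begin
    state n dir (suc (suc c + j))    ≡⟨ state-suc (suc (c + j)) ⟩
    next n (state n dir (suc (c + j))) (dir (suc (c + j)))
                                     ≡⟨ cong (λ q → next n q _) (state-counting start c 1+c≤n) ⟩
    next n (suc c) (dir (suc (c + j))) ≡⟨ next-counting (dir (suc (c + j))) 1+c≤n ⟩
    suc (suc c)                      ∎
    where
    open ≡-Reasoning
    1+c≤n = <⇒≤ 1+c<n

  state-saturated : ∀ {k k′} → n ≤ state n dir k → k ≤ k′ → n ≤ state n dir k′
  state-saturated {k′ = zero}   n≤q z≤n      = n≤q
  state-saturated {k′ = suc k′} n≤q k≤1+k′ with m≤n⇒m<n∨m≡n k≤1+k′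
  ... | inj₁ (s≤s k≤k′) = subst (n ≤_) (sym (state-suc k′)) (next-saturated (state-saturated n≤q k≤k′))
  ... | inj₂ refl       = n≤q

  counter-started-by-A : ∀ {k} c → c < n → state n dir (suc (c + k)) ≡ suc c →
                         out n (state n dir k) (dir k) ≡ A
  counter-started-by-A {k} zero    0<n   q≡1   = next≡1⇒out≡A 0<n (trans (sym (state-suc k)) q≡1)
  counter-started-by-A {k} (suc c) 1+c<n q≡2+c =
    counter-started-by-A c (<⇒≤ 1+c<n)
      (next≡2+c⇒≡1+c 1+c<n (trans (sym (state-suc (suc (c + k)))) q≡2+c))

CFree⇒inPaths : ∀ {n w} → 0 < n → (∀ k → w k ≢ C) → inPaths (tree n) w
CFree⇒inPaths {n} {w} 0<n noC = w , λ k → sym (begin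
  out n (state n w k) (w k)  ≡⟨ cong (λ q → out n q (w k)) (state-idle w {k} (λ i _ → noC i)) ⟩
  out n 0 (w k)              ≡⟨ out-< {i = w k} 0<n ⟩
  toAB (w k)                 ≡⟨ toAB-≢C (noC k) ⟩
  w k                        ∎)
  where open ≡-Reasoning

module A-before-firstC {c : ℕ} {w : ωWord 3} {j : ℕ} (wj≡A : w j ≡ A)
  (noC : ∀ k → k < suc c + j → w k ≢ C) (allC : ∀ k → suc c + j ≤ k → w k ≡ C) where

  private
    n = suc c

  -- Follow w itself, except for turning into direction C at j, which emits A and starts the counter.
  dir : ℕ → Fin 3
  dir k with k ≟ j
  ... | yes _ = C
  ... | no  _ = w k

  dir-j : dir j ≡ C
  dir-j with j ≟ j
  ... | yes _   = refl
  ... | no  j≢j = ⊥-elim (j≢j refl)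

  dir-≢ : ∀ {k} → k ≢ j → dir k ≡ w k
  dir-≢ {k} k≢j with k ≟ j
  ... | yes k≡j = ⊥-elim (k≢j k≡j)
  ... | no  _   = refl

  toAB-dir : ∀ {k} → k < n + j → k ≢ j → toAB (dir k) ≡ w k
  toAB-dir k<n+j k≢j = trans (cong toAB (dir-≢ k≢j)) (toAB-≢C (noC _ k<n+j))

  ≤j⇒<n+j : ∀ {k} → k ≤ j → k < n + j
  ≤j⇒<n+j k≤j = s≤s (≤-trans k≤j (m≤n+m j c))

  idle : ∀ {k} → k ≤ j → state n dir k ≡ 0
  idle k≤j = state-idle dir λ i i<k →
    let i<j = <-≤-trans i<k k≤j in subst (_≢ C) (sym (dir-≢ (<⇒≢ i<j))) (noC i (≤j⇒<n+j (<⇒≤ i<j)))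

  started : state n dir (suc j) ≡ 1
  started = trans (state-suc dir j) (cong₂ (next n) (idle ≤-refl) dir-j)

  idle-letter : ∀ {k} → k ≤ j → toAB (dir k) ≡ w k
  idle-letter k≤j with m≤n⇒m<n∨m≡n k≤j
  ... | inj₁ k<j  = toAB-dir (≤j⇒<n+j k≤j) (<⇒≢ k<j)
  ... | inj₂ refl = trans (cong toAB dir-j) (sym wj≡A)

  Emits : ℕ → Set
  Emits k = w k ≡ out n (state n dir k) (dir k)

  emits-idle : ∀ {k} → k ≤ j → Emits k
  emits-idle {k} k≤j = sym (begin
    out n (state n dir k) (dir k)  ≡⟨ cong (λ q → out n q (dir k)) (idle k≤j) ⟩
    out n 0 (dir k)                ≡⟨ out-< {n} {i = dir k} (s≤s z≤n) ⟩
    toAB (dir k)                   ≡⟨ idle-letter k≤j ⟩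
    w k                            ∎)
    where open ≡-Reasoning

  emits-counting : ∀ {i} → i < c → Emits (suc (i + j))
  emits-counting {i} i<c = sym (begin
    out n (state n dir k) (dir k)  ≡⟨ cong (λ q → out n q (dir k)) (state-counting dir started i (m<n⇒m<1+n i<c)) ⟩
    out n (suc i) (dir k)          ≡⟨ out-< {i = dir k} (s≤s i<c) ⟩
    toAB (dir k)                   ≡⟨ toAB-dir (s≤s (+-monoˡ-< j i<c)) (<⇒≢ (s≤s (m≤n+m j i)) ∘ sym) ⟩
    w k                            ∎)
    where
    open ≡-Reasoning
    k = suc (i + j)

  emits-saturated : ∀ {k} → n + j ≤ k → Emits k
  emits-saturated n+j≤k = trans (allC _ n+j≤k) (sym (out-≥ (state-saturated dir n≤state n+j≤k)))
    where n≤state = ≤-reflexive (sym (state-counting dir started c ≤-refl))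

  emits : ∀ k → Emits k
  emits k with k ≤? j
  ... | yes k≤j = emits-idle k≤j
  ... | no  k≰j = subst Emits k≡ (emits-after (k ∸ suc j))
    where
    k≡ : suc (k ∸ suc j + j) ≡ k
    k≡ = trans (sym (+-suc (k ∸ suc j) j)) (m∸n+n≡m (≰⇒> k≰j))
    emits-after : ∀ i → Emits (suc (i + j))
    emits-after i with i <? c
    ... | yes i<c = emits-counting i<c
    ... | no  i≮c = emits-saturated (s≤s (+-monoˡ-≤ j (≮⇒≥ i≮c)))

A-before-firstC⇒inPaths : ∀ {n w j} → w j ≡ A → (∀ k → k < n + j → w k ≢ C) →
                          (∀ k → n + j ≤ k → w k ≡ C) → inPaths (tree n) w
A-before-firstC⇒inPaths {zero}  wj≡A _ allC with () ← trans (sym wj≡A) (allC _ ≤-refl)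
A-before-firstC⇒inPaths {suc c} wj≡A noC allC = dir , emits
  where open A-before-firstC {c} wj≡A noC allC

inPaths⇒A-before-firstC : ∀ {n w j} → 0 < n → inPaths (tree n) w → w (n + j) ≡ C →
                  (∀ k → k < n + j → w k ≢ C) → w j ≡ A
inPaths⇒A-before-firstC {suc c} {w} {j} 0<n (dir , emits) firstC noC =
  by-final-state (m≤n⇒m<n∨m≡n (subst (_≤ suc n) (sym (state-suc dir (c + j))) (next-≤ _ _)))
  where
  n = suc c
  q = state n dir (suc (c + j))

  n≤q : n ≤ q
  n≤q = out≡C⇒≥ (trans (sym (emits (suc (c + j)))) firstC)

  by-final-state : q < suc n ⊎ q ≡ suc n → w j ≡ A
  by-final-state (inj₁ q<1+n) =
    trans (emits j) (counter-started-by-A dir c ≤-refl (≤-antisym (≤-pred q<1+n) n≤q))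
  by-final-state (inj₂ q≡1+n) = ⊥-elim (noC (c + j) ≤-refl (trans (emits (c + j)) (out-≥ n≤previous)))
    where n≤previous = next≡1+n⇒≥ 0<n (trans (sym (state-suc dir (c + j))) q≡1+n)

marker : ℕ → ωWord 3
marker zero    _       = C
marker (suc j) zero    = B
marker (suc j) (suc k) = marker j k

marker-< : ∀ {j k} → k < j → marker j k ≡ B
marker-< {suc j} {zero}  _         = refl
marker-< {suc j} {suc k} (s≤s k<j) = marker-< k<j

marker-≥ : ∀ {j k} → j ≤ k → marker j k ≡ C
marker-≥ {zero}          _         = refl
marker-≥ {suc j} {suc k} (s≤s j≤k) = marker-≥ j≤k

inject₁≢C : ∀ (x : Fin 2) → inject₁ x ≢ C
inject₁≢C zero       ()
inject₁≢C (suc zero) ()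

module _ {n : ℕ} (u : Fin n → Fin 2) where

  plain : ωWord 3
  plain = inject₁ ∘ u ++ʷ λ _ → A

  marked : ℕ → ωWord 3
  marked j = inject₁ ∘ u ++ʷ marker j

  plain-inPaths : 0 < n → inPaths (tree n) plain
  plain-inPaths 0<n = CFree⇒inPaths 0<n (++ʷ-all (_≢ C) (inject₁≢C ∘ u) (λ _ ()))

  marked-noC : ∀ {j} k → k < n + j → marked j k ≢ C
  marked-noC = ++ʷ-below (_≢ C) (inject₁≢C ∘ u) (λ k k<j → subst (_≢ C) (sym (marker-< k<j)) λ ())

  marked-allC : ∀ {j} k → n + j ≤ k → marked j k ≡ C
  marked-allC {j} = ++ʷ-above (_≡ C) (λ k → marker-≥ {j} {k})

  marked-at : ∀ i → marked (toℕ i) (toℕ i) ≡ inject₁ (u i)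
  marked-at i = ++ʷ-toℕ (inject₁ ∘ u) (marker (toℕ i)) i

  marked-inPaths : ∀ {i} → u i ≡ zero → inPaths (tree n) (marked (toℕ i))
  marked-inPaths {i} ui≡0 =
    A-before-firstC⇒inPaths (trans (marked-at i) (cong inject₁ ui≡0)) marked-noC marked-allC

  marked-∉paths : ∀ {i} → 0 < n → u i ≡ suc zero → ¬ inPaths (tree n) (marked (toℕ i))
  marked-∉paths {i} 0<n ui≡1 path with () ←
    trans (trans (cong inject₁ (sym ui≡1)) (sym (marked-at i)))
          (inPaths⇒A-before-firstC 0<n path (marked-allC _ ≤-refl) marked-noC)

lowerBound : ∀ {n m} → 0 < n → (M : DBA 3 m) → RecognizesPaths M (tree n) → 2 ^ n ≤ m
lowerBound {n} {m} 0<n M recognizes = ^≤-of-pointwise-injective stateAfter separated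
  where
  plain-accepted : ∀ u → Accepts M (plain u)
  plain-accepted u = proj₂ (recognizes _) (plain-inPaths u 0<n)

  stateAfter : (Fin n → Fin 2) → Fin m
  stateAfter u = run M (plain-accepted u) n

  distinguished : ∀ {u v} i → u i ≡ zero → v i ≡ suc zero → stateAfter u ≢ stateAfter v
  distinguished {u} {v} i ui≡0 vi≡1 same = marked-∉paths v 0<n vi≡1 (proj₁ (recognizes _)
    (accepts-swap-prefix M (inject₁ ∘ u) (inject₁ ∘ v) (plain-accepted u) (plain-accepted v) same
      (proj₂ (recognizes _) (marked-inPaths u ui≡0))))

  separated : ∀ {u v} → stateAfter u ≡ stateAfter v → u ≗ v
  separated {u} {v} same i with u i in ui | v i in vi
  ... | zero     | zero     = refl
  ... | suc zero | suc zero = refl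
  ... | zero     | suc zero = ⊥-elim (distinguished i ui vi same)
  ... | suc zero | zero     = ⊥-elim (distinguished i vi ui (sym same))

next<n+2 : ∀ n q i → next n q i < n + 2
next<n+2 n q i = ≤-trans (s≤s (next-≤ q i)) (≤-reflexive (+-comm 2 n))

0<n+2 : ∀ n → 0 < n + 2
0<n+2 n = ≤-trans (s≤s z≤n) (m≤n+m 2 n)

counterAut : ∀ n → TreeAut 3 3 (n + 2)
counterAut n = boundedAut (next n) (out n) (next<n+2 n) (0<n+2 n)

counterAut-represents : ∀ n → Represents (counterAut n) (tree n)
counterAut-represents n = boundedAut-represents (next n) (out n) (next<n+2 n) (0<n+2 n)

lemma5p3 : Σ ℕ λ s → Σ ℕ λ d → Σ (ℕ → Tree s d) λ t →
    ∀ n →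
      (∃[ A ] Represents {s} {d} {n + 2} A (t n))
      × (∀ m (B : DBA s m) → RecognizesPaths B (t n) → 2 ^ n ≤ m)
lemma5p3 = 3 , 3 , tree , λ n → (counterAut n , counterAut-represents n) , size≥2^n n
  where
  size≥2^n : ∀ n m (M : DBA 3 m) → RecognizesPaths M (tree n) → 2 ^ n ≤ m
  size≥2^n zero    m M _ = ^≤-of-pointwise-injective {2} {0} (λ _ → DBA.q₀ M) (λ _ ())
  size≥2^n (suc n) m M   = lowerBound (s≤s z≤n) M
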